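{- Let $\mathbf I=(I,\rightarrow,0)$ be a lattice effect implication algebra and define, for all $x,y\in I$, $x':=x\rightarrow0$, $1:=0'$, and the partial operation $+$ by: $x+y$ is defined if and only if $x\rightarrow y'=1$, and in this case $x+y:=x'\rightarrow y$. Then $(I,+,{}',0,1)$ is a lattice effect algebra whose induced order $\leq$ satisfies $x\leq y$ if and only if $x\rightarrow y=1$, and whose lattice operations satisfy $x\vee y=(x\rightarrow y)\rightarrow y$ and $x\wedge y=(x'\vee y')'$ for all $x,y\in I$.
   Context: An effect algebra is a structure $(E,+,{}',0,1)$ where $E$ is a set, ${}'$ is a unary operation on $E$, $0,1\in E$, and $+$ is a partial binary operation on $E$ such that for all $x,y,z\in E$: (E1) if $x+y$ is defined then so is $y+x$ and $x+y=y+x$; (E2) $(x+y)+z$ is defined if and only if $x+(y+z)$ is defined, and then they are equal; (E3) $x+y$ is defined and equals $1$ if and only if $y=x'$; (E4) if $1+x$ is defined then $x=0$. The induced order is $x\leq y$ iff there exists $z$ with $x+z=y$. A lattice effect algebra is an effect algebra whose induced order is a lattice order. A lattice effect implication algebra is an algebra $(I,\rightarrow,0)$ with a binary operation $\rightarrow$ and a constant $0$ such that, writing $x':=x\rightarrow0$ and $1:=0'$, for all $x,y,z\in I$: (i) $0\rightarrow x=x\rightarrow x=x\rightarrow1=1$; (ii) if $x\rightarrow y=y\rightarrow x=1$ then $x=y$; (iii) if $x\rightarrow y=y\rightarrow z=1$ then $x\rightarrow z=1$; (iv) if $x\rightarrow y=1$ then $y'\rightarrow x'=1$; (v) $x''=x$;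 (vi) $x\rightarrow((x\rightarrow y)\rightarrow y)=1$; (vii) $y\rightarrow((x\rightarrow y)\rightarrow y)=1$; (viii) if $x\rightarrow z=y\rightarrow z=1$ then $((x\rightarrow y)\rightarrow y)\rightarrow z=1$; (ix) if $x\rightarrow y=1$ then $y\rightarrow x=x'\rightarrow y'$; (x) [$x\rightarrow y'=1$ and $(x'\rightarrow y)\rightarrow z'=1$] if and only if [$y\rightarrow z'=1$ and $x\rightarrow(y'\rightarrow z)'=1$], and in this case $(x'\rightarrow y)'\rightarrow z=x'\rightarrow(y'\rightarrow z)$; (xi) $y'\rightarrow((x\rightarrow y)\rightarrow y)'=x\rightarrow y$; (xii) $x\rightarrow(y\rightarrow x)=1$. -}

module Defs where

open import Level using (Level; _⊔_; suc)
open import Data.Product using (Σ; ∃; _×_; _,_)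
open import Relation.Binary.PropositionalEquality using (_≡_)
open import Relation.Binary.Structures using (IsPartialOrder)
open import Relation.Binary.Lattice.Structures using (IsLattice)

-- A partial binary operation on A is represented by its graph:
-- Sum x y z  means  "x + y is defined and x + y = z".
-- Functionality of the graph is required explicitly.
record IsEffectAlgebra {a ℓ : Level} {A : Set a}
         (Sum : A → A → A → Set ℓ) (_′ : A → A) (0# 1# : A) : Set (a ⊔ ℓ) where
  field
    functional : ∀ {x y z w} → Sum x y z → Sum x y w → z ≡ w
    E1 : ∀ {x y z} → Sum x y z → Sum y x z
    E2→ : ∀ {x y z d e} → Sum x y d → Sum d z e →
          Σ A λ f → Sum y z f × Sum x f e
    E2← : ∀ {x y z f e} → Sum y z f → Sum x f e →
          Σ A λ d → Sum x y d × Sum d z e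
    E3→ : ∀ {x y} → Sum x y 1# → y ≡ x ′
    E3← : ∀ {x y} → y ≡ x ′ → Sum x y 1#
    E4 : ∀ {x z} → Sum 1# x z → x ≡ 0#

induced≤ : {a ℓ : Level} {A : Set a} → (A → A → A → Set ℓ) → A → A → Set (a ⊔ ℓ)
induced≤ {A = A} Sum x y = Σ A λ z → Sum x z y

record IsLEIA {a : Level} {I : Set a} (_⇒_ : I → I → I) (0# : I) : Set a where
  _′ : I → I
  x ′ = x ⇒ 0#
  1# : I
  1# = 0# ′
  field
    i₁ : ∀ x → 0# ⇒ x ≡ 1#
    i₂ : ∀ x → x ⇒ x ≡ 1#
    i₃ : ∀ x → x ⇒ 1# ≡ 1#
    ii : ∀ {x y} → x ⇒ y ≡ 1# → y ⇒ x ≡ 1# → x ≡ y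
    iii : ∀ {x y z} → x ⇒ y ≡ 1# → y ⇒ z ≡ 1# → x ⇒ z ≡ 1#
    iv : ∀ {x y} → x ⇒ y ≡ 1# → (y ′) ⇒ (x ′) ≡ 1#
    v : ∀ x → (x ′) ′ ≡ x
    vi : ∀ x y → x ⇒ ((x ⇒ y) ⇒ y) ≡ 1#
    vii : ∀ x y → y ⇒ ((x ⇒ y) ⇒ y) ≡ 1#
    viii : ∀ {x y z} → x ⇒ z ≡ 1# → y ⇒ z ≡ 1# → ((x ⇒ y) ⇒ y) ⇒ z ≡ 1#
    ix : ∀ {x y} → x ⇒ y ≡ 1# → y ⇒ x ≡ (x ′) ⇒ (y ′)
    x→ : ∀ {x y z} → x ⇒ (y ′) ≡ 1# × ((x ′) ⇒ y) ⇒ (z ′) ≡ 1# →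
         y ⇒ (z ′) ≡ 1# × x ⇒ (((y ′) ⇒ z) ′) ≡ 1#
    x← : ∀ {x y z} → y ⇒ (z ′) ≡ 1# × x ⇒ (((y ′) ⇒ z) ′) ≡ 1# →
         x ⇒ (y ′) ≡ 1# × ((x ′) ⇒ y) ⇒ (z ′) ≡ 1#
    x≡ : ∀ {x y z} → x ⇒ (y ′) ≡ 1# × ((x ′) ⇒ y) ⇒ (z ′) ≡ 1# →
         (((x ′) ⇒ y) ′) ⇒ z ≡ (x ′) ⇒ (((y ′) ⇒ z))
    xi : ∀ x y → (y ′) ⇒ (((x ⇒ y) ⇒ y) ′) ≡ x ⇒ y
    xii : ∀ x y → x ⇒ (y ⇒ x) ≡ 1#

module LEIAOps {a : Level} {I : Set a} (_⇒_ : I → I → I) (0# : I) where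
  _′ : I → I
  x ′ = x ⇒ 0#
  1# : I
  1# = 0# ′
  SumI : I → I → I → Set a
  SumI x y z = (x ⇒ (y ′) ≡ 1#) × (z ≡ (x ′) ⇒ y)
  _≤I_ : I → I → Set a
  _≤I_ = induced≤ SumI
  _∨I_ : I → I → I
  x ∨I y = (x ⇒ y) ⇒ y
  _∧I_ : I → I → I
  x ∧I y = ((x ′) ∨I (y ′)) ′

-- Reading x ⇒ y ≡ 1 as x ⊑ y, axioms (ii), (iii), (i) make ⊑ a partial order, (vi)–(viii)
-- say that (x ⇒ y) ⇒ y is the join, and x ↦ x ′ is an involutive order-reversal by (iv), (v),
-- which turns the join into the meet (x ′ ∨ y ′) ′. Commutativity of + is (ix), associativity
-- is (x), and (xii) shows that x ⊑ x + z. Conversely, if x ⊑ y then x + y ′ is defined, and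
-- the associativity of (y ′ + x) + (x + y ′) ′ = 1 yields z with x + z = y.
module Submission where

open import Defs
open import Level using (Level)
open import Data.Product using (_×_; _,_; Σ)
open import Function.Bundles using (_⇔_; mk⇔)
open import Relation.Binary.PropositionalEquality
  using (_≡_; refl; sym; trans; subst; cong; isEquivalence)
open import Relation.Binary.Lattice.Structures using (IsLattice)

module LEIATheory {a : Level} {I : Set a} (_⇒_ : I → I → I) (0# : I) (L : IsLEIA _⇒_ 0#) where
  open LEIAOps _⇒_ 0#
  open IsLEIA L using (i₂; i₃; ii; iii; iv; v; vi; vii; viii; ix; x→; x←; x≡; xii)

  infix 4 _⊑_
  _⊑_ : I → I → Set a
  x ⊑ y = x ⇒ y ≡ 1#

  ⊑-respʳ-≡ : ∀ {x y z} → y ≡ z → x ⊑ y → x ⊑ z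
  ⊑-respʳ-≡ {x} = subst (x ⊑_)

  ⊑-respˡ-≡ : ∀ {x y z} → x ≡ y → x ⊑ z → y ⊑ z
  ⊑-respˡ-≡ {z = z} = subst (_⊑ z)

  ⊑-swapʳ′ : ∀ {x y} → x ⊑ y ′ → y ⊑ x ′
  ⊑-swapʳ′ {y = y} p = ⊑-respˡ-≡ (v y) (iv p)

  ⊑-swapˡ′ : ∀ {x y} → x ′ ⊑ y → y ′ ⊑ x
  ⊑-swapˡ′ {x} p = ⊑-respʳ-≡ (v x) (iv p)

  ⇒-swap′ : ∀ {x y} → x ⊑ y ′ → (y ′) ⇒ x ≡ (x ′) ⇒ y
  ⇒-swap′ {x} {y} p = trans (ix p) (cong ((x ′) ⇒_) (v y))

  sum-functional : ∀ {x y z w} → SumI x y z → SumI x y w → z ≡ w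
  sum-functional (_ , refl) (_ , refl) = refl

  sum-comm : ∀ {x y z} → SumI x y z → SumI y x z
  sum-comm (p , refl) = ⊑-swapʳ′ p , sym (⇒-swap′ p)

  sum-assocˡ : ∀ {x y z d e} → SumI x y d → SumI d z e → Σ I λ f → SumI y z f × SumI x f e
  sum-assocˡ {y = y} {z} (p , refl) (q , refl) =
    let r , s = x→ (p , q) in (y ′) ⇒ z , (r , refl) , (s , x≡ (p , q))

  sum-assocʳ : ∀ {x y z f e} → SumI y z f → SumI x f e → Σ I λ d → SumI x y d × SumI d z e
  sum-assocʳ {x} {y} (p , refl) (q , refl) =
    let r , s = x← (p , q) in (x ′) ⇒ y , (r , refl) , (s , sym (x≡ (r , s)))

  sum-≡1⇒′ : ∀ {x y} → SumI x y 1# → y ≡ x ′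
  sum-≡1⇒′ (p , e) = ii (⊑-swapʳ′ p) (sym e)

  sum-′≡1 : ∀ {x y} → y ≡ x ′ → SumI x y 1#
  sum-′≡1 {x} refl = ⊑-respʳ-≡ (sym (v x)) (i₂ x) , sym (i₂ (x ′))

  sum-1ˡ⇒0 : ∀ {x z} → SumI 1# x z → x ≡ 0#
  sum-1ˡ⇒0 {x} (p , _) = trans (sym (v x)) (trans (cong _′ (ii (i₃ (x ′)) p)) (v 0#))

  isEffectAlgebra : IsEffectAlgebra SumI _′ 0# 1#
  isEffectAlgebra = record
    { functional = sum-functional
    ; E1 = sum-comm
    ; E2→ = sum-assocˡ
    ; E2← = sum-assocʳ
    ; E3→ = sum-≡1⇒′
    ; E3← = sum-′≡1
    ; E4 = sum-1ˡ⇒0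
    }

  ≤I⇒⊑ : ∀ {x y} → x ≤I y → x ⊑ y
  ≤I⇒⊑ {x} (z , p , refl) = ⊑-respʳ-≡ (⇒-swap′ p) (xii x (z ′))

  ⊑⇒≤I : ∀ {x y} → x ⊑ y → x ≤I y
  ⊑⇒≤I {x} {y} x⊑y =
    let _ , x+u′ , y′+f≡1 = sum-assocˡ (sum-comm x+y′) (sum-′≡1 refl)
    in _ , subst (SumI x _) (trans (sum-≡1⇒′ y′+f≡1) (v y)) x+u′
    where
    x+y′ : SumI x (y ′) ((x ′) ⇒ (y ′))
    x+y′ = ⊑-respʳ-≡ (sym (v y)) x⊑y , refl

  ≤I⇔⊑ : ∀ x y → (x ≤I y) ⇔ (x ⊑ y)
  ≤I⇔⊑ x y = mk⇔ ≤I⇒⊑ ⊑⇒≤I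

  ∨-upperˡ : ∀ x y → x ⊑ (x ∨I y)
  ∨-upperˡ = vi

  ∨-upperʳ : ∀ x y → y ⊑ (x ∨I y)
  ∨-upperʳ = vii

  ∨-least : ∀ {x y z} → x ⊑ z → y ⊑ z → (x ∨I y) ⊑ z
  ∨-least = viii

  ∧-lowerˡ : ∀ x y → (x ∧I y) ⊑ x
  ∧-lowerˡ x y = ⊑-swapˡ′ (∨-upperˡ (x ′) (y ′))

  ∧-lowerʳ : ∀ x y → (x ∧I y) ⊑ y
  ∧-lowerʳ x y = ⊑-swapˡ′ (∨-upperʳ (x ′) (y ′))

  ∧-greatest : ∀ {x y z} → z ⊑ x → z ⊑ y → z ⊑ (x ∧I y)
  ∧-greatest p q = ⊑-swapʳ′ (∨-least (iv p) (iv q))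

  isLattice : IsLattice _≡_ _≤I_ _∨I_ _∧I_
  isLattice = record
    { isPartialOrder = record
      { isPreorder = record
        { isEquivalence = isEquivalence
        ; reflexive = λ { {x} refl → ⊑⇒≤I (i₂ x) }
        ; trans = λ p q → ⊑⇒≤I (iii (≤I⇒⊑ p) (≤I⇒⊑ q))
        }
      ; antisym = λ p q → ii (≤I⇒⊑ p) (≤I⇒⊑ q)
      }
    ; supremum = λ x y →
        ⊑⇒≤I (∨-upperˡ x y) , ⊑⇒≤I (∨-upperʳ x y) ,
        λ _ p q → ⊑⇒≤I (∨-least (≤I⇒⊑ p) (≤I⇒⊑ q))
    ; infimum = λ x y →
        ⊑⇒≤I (∧-lowerˡ x y) , ⊑⇒≤I (∧-lowerʳ x y) ,
        λ _ p q → ⊑⇒≤I (∧-greatest (≤I⇒⊑ p) (≤I⇒⊑ q))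
    }

theorem2p5 : {a : Level} {I : Set a} (_⇒_ : I → I → I) (0# : I) →
    IsLEIA _⇒_ 0# →
    let open LEIAOps _⇒_ 0# in
    IsEffectAlgebra SumI _′ 0# 1#
    × IsLattice _≡_ _≤I_ _∨I_ _∧I_
    × (∀ x y → (x ≤I y) ⇔ (x ⇒ y ≡ 1#))
theorem2p5 _⇒_ 0# L = isEffectAlgebra , isLattice , ≤I⇔⊑
  where open LEIATheory _⇒_ 0# L
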